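{- Let $U$ be a finite nonempty set, $c\in\mathbb{N}$, $w:U\to\mathbb{R}$ with $0<w(u)\le c$ for all $u\in U$. Let $P,P_1,P_2$ be sets of subsets of $U$ and $B_1,B_2,V\subseteq U$. If $\mathrm{bp}(P)$, $\mathrm{inv}_1(P_1,P_2,B_1,B_2,V)$ and $\mathrm{bij\_exists}(P_1,\bigcup(P_2\cup[\![B_2]\!]))$ hold, then $|P_1|+1\le|P|$.
   Context: $W(B)=\sum_{u\in B}w(u)$. $[\![B]\!]=\emptyset$ if $B=\emptyset$, else $\{B\}$. $\mathrm{bp}(P)$ holds iff $P$ is a partition of $U$ ($\bigcup P=U$, elements pairwise disjoint, $\emptyset\notin P$) and $W(B)\le c$ for all $B\in P$. $\mathrm{inv}_1(P_1,P_2,B_1,B_2,V)$ holds iff: $\mathrm{bp}(P_1\cup[\![B_1]\!]\cup P_2\cup[\![B_2]\!]\cup\{\{v\}\mid v\in V\})$; $\bigcup(P_1\cup[\![B_1]\!]\cup P_2\cup[\![B_2]\!])=U\setminus V$; $B_1\notin P_1\cup P_2\cup[\![B_2]\!]$; $B_2\notin P_1\cup[\![B_1]\!]\cup P_2$; and $(P_1\cup[\![B_1]\!])\cap(P_2\cup[\![B_2]\!])=\emptyset$. $\mathrm{bij\_exists}(Q,X)$ holds iff there is a bijection $f:Q\to X$ with $c<W(B)+w(f(B))$ for all $B\in Q$. -}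

module Defs where

open import Level using (Level; _⊔_) renaming (suc to lsuc)
open import Data.Nat using (ℕ; zero; suc)
open import Data.Bool using (Bool; true; false; if_then_else_)
import Data.Bool as Bool
open import Data.Fin using (Fin)
import Data.Fin as Fin
open import Data.Fin.Subset using (Subset; ⁅_⁆; _∈_; _∉_) renaming (⊥ to ∅)
open import Data.Vec using (Vec; []; _∷_)
import Data.Vec
import Data.Fin.Subset.Properties
import Data.Vec.Properties as VecP
open import Data.List using (List; []; _∷_; _++_; length; deduplicate)
open import Data.List.Membership.Propositional using () renaming (_∈_ to _∈ₗ_; _∉_ to _∉ₗ_)
open import Data.Product using (Σ; ∃; _×_; _,_)
open import Data.Sum using (_⊎_)
open import Data.Empty using (⊥)
open import Relation.Nullary using (¬_; does)
open import Relation.Binary using (Rel; IsStrictTotalOrder; DecidableEquality)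
open import Relation.Binary.PropositionalEquality using (_≡_; _≢_)
open import Algebra.Bundles using (CommutativeRing)

-- Weights live in an arbitrary (totally) ordered commutative ring.
-- The paper uses ℝ, which is an instance; agda-stdlib has no reals.

record OrderedCommutativeRing (a ℓ₁ ℓ₂ : Level) : Set (lsuc (a ⊔ ℓ₁ ⊔ ℓ₂)) where
  field
    commutativeRing : CommutativeRing a ℓ₁
  open CommutativeRing commutativeRing public
  field
    _<_                : Rel Carrier ℓ₂
    isStrictTotalOrder : IsStrictTotalOrder _≈_ _<_
    +-monoˡ-<          : ∀ z {x y} → x < y → (x + z) < (y + z)
    *-pos              : ∀ {x y} → 0# < x → 0# < y → 0# < (x * y)

  infix 4 _≤_
  _≤_ : Carrier → Carrier → Set (ℓ₁ ⊔ ℓ₂)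
  x ≤ y = (x < y) ⊎ (x ≈ y)

  fromℕ : ℕ → Carrier
  fromℕ zero    = 0#
  fromℕ (suc k) = 1# + fromℕ k

-- U = Fin n (the whole type); subsets of U are
-- 'Subset n'; a (finite) set of subsets of U is represented by a list,
-- read as the set of its members (all notions below only use
-- membership; cardinality counts distinct members).

module BinPacking {a ℓ₁ ℓ₂} (R : OrderedCommutativeRing a ℓ₁ ℓ₂) where
  open OrderedCommutativeRing R

  _≟ₛ_ : ∀ {n} → DecidableEquality (Subset n)
  _≟ₛ_ = VecP.≡-dec Bool._≟_

  W : ∀ {n} → (Fin n → Carrier) → Subset n → Carrier
  W {zero}  w []          = 0#
  W {suc n} w (true  ∷ B) = w Fin.zero + W (λ i → w (Fin.suc i)) B
  W {suc n} w (false ∷ B) = W (λ i → w (Fin.suc i)) B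

  ⟦_⟧ : ∀ {n} → Subset n → List (Subset n)
  ⟦ B ⟧ = if does (B ≟ₛ ∅) then [] else (B ∷ [])

  _∈⋃_ : ∀ {n} → Fin n → List (Subset n) → Set
  u ∈⋃ Q = ∃ λ B → (B ∈ₗ Q) × (u ∈ B)

  singletons : ∀ {n} → Subset n → List (Subset n)
  singletons {n} V = go (Data.Vec.allFin n)
    where
      go : ∀ {k} → Vec (Fin n) k → List (Subset n)
      go []       = []
      go (v ∷ vs) = if does (Data.Fin.Subset.Properties._∈?_ v V)
                      then ⁅ v ⁆ ∷ go vs else go vs

  card : ∀ {n} → List (Subset n) → ℕ
  card Q = length (deduplicate _≟ₛ_ Q)

  module _ {n : ℕ} (w : Fin n → Carrier) (c : ℕ) where

    record bp (P : List (Subset n)) : Set (ℓ₁ ⊔ ℓ₂) where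
      field
        covers   : ∀ (u : Fin n) → u ∈⋃ P
        disjoint : ∀ {B B′} → B ∈ₗ P → B′ ∈ₗ P → B ≢ B′ →
                   ∀ (u : Fin n) → u ∈ B → u ∈ B′ → ⊥
        nonEmpty : ∅ ∉ₗ P
        capacity : ∀ {B} → B ∈ₗ P → W w B ≤ fromℕ c

    record inv₁ (P₁ P₂ : List (Subset n)) (B₁ B₂ V : Subset n) : Set (ℓ₁ ⊔ ℓ₂) where
      field
        isBp      : bp (P₁ ++ ⟦ B₁ ⟧ ++ P₂ ++ ⟦ B₂ ⟧ ++ singletons V)
        union     : ∀ (u : Fin n) →
                    (u ∈⋃ (P₁ ++ ⟦ B₁ ⟧ ++ P₂ ++ ⟦ B₂ ⟧) → u ∉ V)
                    × (u ∉ V → u ∈⋃ (P₁ ++ ⟦ B₁ ⟧ ++ P₂ ++ ⟦ B₂ ⟧))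
        B₁-fresh  : B₁ ∉ₗ (P₁ ++ P₂ ++ ⟦ B₂ ⟧)
        B₂-fresh  : B₂ ∉ₗ (P₁ ++ ⟦ B₁ ⟧ ++ P₂)
        disj      : ∀ {B} → B ∈ₗ (P₁ ++ ⟦ B₁ ⟧) → B ∈ₗ (P₂ ++ ⟦ B₂ ⟧) → ⊥

    bij-exists : List (Subset n) → (Fin n → Set) → Set ℓ₂
    bij-exists Q X =
      Σ (Subset n → Fin n) λ f →
          (∀ {B} → B ∈ₗ Q → X (f B))
        × (∀ {B B′} → B ∈ₗ Q → B′ ∈ₗ Q → f B ≡ f B′ → B ≡ B′)
        × (∀ (x : Fin n) → X x → ∃ λ B → (B ∈ₗ Q) × (f B ≡ x))
        × (∀ {B} → B ∈ₗ Q → fromℕ c < (W w B + w (f B)))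

-- Every bin B of P₁ is paired by f with an item f B outside all bins of P₁, and the
-- extended bins B ∪ {f B} are pairwise disjoint and each weighs more than c.  Hence
-- the total weight exceeds |P₁|·c, whereas any packing P with bins of weight at most c
-- has total weight at most |P|·c.  When P₁ is empty, |P| ≥ 1 because U is nonempty.

module Submission where

open import Defs
open import Level using (Level)
open import Data.Nat as ℕ using (ℕ; zero; suc; z≤n; s≤s)
import Data.Nat.Properties as ℕ
open import Data.Bool using (true; false)
open import Data.Fin using (Fin)
import Data.Fin as Fin
open import Data.Fin.Subset using (Subset; ⁅_⁆; _∈_; _∉_; _∪_; ⋃; ⊤; _⊆_) renaming (⊥ to ∅)
open import Data.Fin.Subset.Properties
  using (x∈⁅y⁆⇒x≡y; x∈p∪q⁺; x∈p∪q⁻; drop-∷-⊆; ∉⊥; ⊆⊤)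
open import Data.Vec using ([]; _∷_; here; there)
open import Data.List using (List; []; _∷_; _++_; length; map; foldr; deduplicate)
open import Data.List.Properties using (length-map; ++-assoc)
open import Data.List.Membership.Propositional using () renaming (_∈_ to _∈ₗ_)
open import Data.List.Membership.Propositional.Properties
  using (∈-++⁺ˡ; ∈-++⁺ʳ; ∈-deduplicate⁺; ∈-deduplicate⁻)
open import Data.List.Relation.Unary.Any using (here; there)
open import Data.List.Relation.Unary.All as All using (All; []; _∷_)
import Data.List.Relation.Unary.All.Properties as All
open import Data.List.Relation.Unary.AllPairs using (AllPairs; []; _∷_)
import Data.List.Relation.Unary.AllPairs.Properties as AllPairs
import Data.List.Relation.Unary.Unique.DecPropositional.Properties as Unique
open import Data.Product using (_×_; _,_; proj₁; proj₂)
open import Data.Sum using (inj₁; inj₂)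
open import Data.Empty using (⊥; ⊥-elim)
open import Function using (_∘_)
open import Relation.Nullary using (yes; no)
open import Relation.Binary using (Rel; IsStrictTotalOrder; StrictPartialOrder)
open import Relation.Binary.PropositionalEquality as ≡ using (_≡_; _≢_)
import Relation.Binary.Construct.StrictToNonStrict as StrictToNonStrict
import Relation.Binary.Reasoning.StrictPartialOrder as StrictPartialOrderReasoning
import Algebra.Definitions.RawMonoid as RawMonoidDefinitions
import Algebra.Properties.CommutativeSemigroup as CommutativeSemigroupProperties

AllPairs-mapWith∈ : ∀ {A : Set} {R S : Rel A Level.zero} {xs : List A} →
                    (∀ {x y} → x ∈ₗ xs → y ∈ₗ xs → R x y → S x y) →
                    AllPairs R xs → AllPairs S xs
AllPairs-mapWith∈ R⇒S [] = []
AllPairs-mapWith∈ R⇒S (Rx ∷ Rxs) =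
  All.tabulate (λ y∈ → R⇒S (here ≡.refl) (there y∈) (All.lookup Rx y∈))
  ∷ AllPairs-mapWith∈ (λ x∈ y∈ → R⇒S (there x∈) (there y∈)) Rxs

∈⇒0<length : ∀ {A : Set} {x : A} {xs : List A} → x ∈ₗ xs → 0 ℕ.< length xs
∈⇒0<length {xs = _ ∷ _} _ = s≤s z≤n

<-when-positive : ∀ {m n} → 0 ℕ.< n → (0 ℕ.< m → m ℕ.< n) → m ℕ.< n
<-when-positive {zero}  0<n _       = 0<n
<-when-positive {suc m} _   0<m⇒m<n = 0<m⇒m<n (s≤s z≤n)

module OrderedCommutativeRingProperties {a ℓ₁ ℓ₂} (R : OrderedCommutativeRing a ℓ₁ ℓ₂) where
  open OrderedCommutativeRing R hiding (zero)
  open IsStrictTotalOrder isStrictTotalOrder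
    using (isStrictPartialOrder; irrefl; <-resp-≈; <-respˡ-≈; <-respʳ-≈)
    renaming (trans to <-trans)
  open RawMonoidDefinitions +-rawMonoid using () renaming (_×_ to _·_) public

  strictPartialOrder : StrictPartialOrder a ℓ₁ ℓ₂
  strictPartialOrder = record { isStrictPartialOrder = isStrictPartialOrder }

  module ≤-Reasoning = StrictPartialOrderReasoning strictPartialOrder

  ≤-trans : ∀ {x y z} → x ≤ y → y ≤ z → x ≤ z
  ≤-trans = StrictToNonStrict.trans _≈_ _<_ isEquivalence <-resp-≈ <-trans

  <-≤-trans : ∀ {x y z} → x < y → y ≤ z → x < z
  <-≤-trans = StrictToNonStrict.<-≤-trans _≈_ _<_ <-trans <-respʳ-≈

  +-monoʳ-< : ∀ z {x y} → x < y → (z + x) < (z + y)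
  +-monoʳ-< z {x} {y} x<y = <-respʳ-≈ (+-comm y z) (<-respˡ-≈ (+-comm x z) (+-monoˡ-< z x<y))

  +-monoˡ-≤ : ∀ z {x y} → x ≤ y → x + z ≤ y + z
  +-monoˡ-≤ z (inj₁ x<y) = inj₁ (+-monoˡ-< z x<y)
  +-monoˡ-≤ z (inj₂ x≈y) = inj₂ (+-cong x≈y refl)

  +-monoʳ-≤ : ∀ z {x y} → x ≤ y → z + x ≤ z + y
  +-monoʳ-≤ z (inj₁ x<y) = inj₁ (+-monoʳ-< z x<y)
  +-monoʳ-≤ z (inj₂ x≈y) = inj₂ (+-cong refl x≈y)

  +-mono-≤ : ∀ {x y u v} → x ≤ y → u ≤ v → x + u ≤ y + v
  +-mono-≤ {y = y} x≤y u≤v = ≤-trans (+-monoˡ-≤ _ x≤y) (+-monoʳ-≤ y u≤v)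

  +-mono-<-≤ : ∀ {x y u v} → x < y → u ≤ v → (x + u) < (y + v)
  +-mono-<-≤ {y = y} x<y u≤v = <-≤-trans (+-monoˡ-< _ x<y) (+-monoʳ-≤ y u≤v)

  x≤y+x : ∀ {x y} → 0# ≤ y → x ≤ y + x
  x≤y+x {x} {y} 0≤y = ≤-trans (inj₂ (sym (+-identityˡ x))) (+-monoˡ-≤ x 0≤y)

  ·-monoˡ-≤ : ∀ {x} → 0# ≤ x → ∀ {m n} → m ℕ.≤ n → m · x ≤ n · x
  ·-monoˡ-≤     0≤x {zero}  {zero}  _         = inj₂ refl
  ·-monoˡ-≤ {x} 0≤x {zero}  {suc n} _         = begin
    0#         ≤⟨ 0≤x ⟩
    x          ≈⟨ sym (+-identityʳ x) ⟩
    x + 0#     ≤⟨ +-monoʳ-≤ x (·-monoˡ-≤ 0≤x {zero} {n} z≤n) ⟩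
    x + n · x  ∎
    where open ≤-Reasoning
  ·-monoˡ-≤     0≤x {suc m} {suc n} (s≤s m≤n) = +-monoʳ-≤ _ (·-monoˡ-≤ 0≤x m≤n)

  ·-cancelʳ-< : ∀ {x} → 0# ≤ x → ∀ {m n} → (m · x) < (n · x) → m ℕ.< n
  ·-cancelʳ-< 0≤x {m} {n} m·x<n·x with m ℕ.<? n
  ... | yes m<n = m<n
  ... | no  m≮n = ⊥-elim (irrefl refl (<-≤-trans m·x<n·x (·-monoˡ-≤ 0≤x (ℕ.≮⇒≥ m≮n))))

  sum : List Carrier → Carrier
  sum = foldr _+_ 0#

  module _ {A : Set} (f : A → Carrier) (x : Carrier) where

    sum-map-≤-· : ∀ {xs} → All (λ i → f i ≤ x) xs → sum (map f xs) ≤ length xs · x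
    sum-map-≤-· []            = inj₂ refl
    sum-map-≤-· (fi≤x ∷ fxs≤x) = +-mono-≤ fi≤x (sum-map-≤-· fxs≤x)

    ·-<-sum-map : ∀ {xs} → 0 ℕ.< length xs → All (λ i → x < f i) xs → (length xs · x) < sum (map f xs)
    ·-<-sum-map _ (x<fi ∷ x<fxs) = +-mono-<-≤ x<fi (·-≤-sum-map x<fxs)
      where
      ·-≤-sum-map : ∀ {xs} → All (λ i → x < f i) xs → length xs · x ≤ sum (map f xs)
      ·-≤-sum-map []             = inj₂ refl
      ·-≤-sum-map (x<fi ∷ x<fxs) = +-mono-≤ (inj₁ x<fi) (·-≤-sum-map x<fxs)

module BinPackingProperties {a ℓ₁ ℓ₂} (R : OrderedCommutativeRing a ℓ₁ ℓ₂) where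
  open OrderedCommutativeRing R hiding (zero)
  open BinPacking R
  open OrderedCommutativeRingProperties R
  open IsStrictTotalOrder isStrictTotalOrder using (<-respʳ-≈)
  open CommutativeSemigroupProperties +-commutativeSemigroup using (x∙yz≈y∙xz)

  Disjoint : ∀ {n} → Subset n → Subset n → Set
  Disjoint A B = ∀ {u} → u ∈ A → u ∈ B → ⊥

  NonNegative : ∀ {n} → (Fin n → Carrier) → Set (ℓ₁ Level.⊔ ℓ₂)
  NonNegative w = ∀ i → 0# ≤ w i

  private
    tail : ∀ {n} → (Fin (suc n) → Carrier) → Fin n → Carrier
    tail w i = w (Fin.suc i)

  W-∅ : ∀ {n} (w : Fin n → Carrier) → W w ∅ ≈ 0#
  W-∅ {zero}  w = refl
  W-∅ {suc n} w = W-∅ (tail w)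

  W-⁅⁆ : ∀ {n} (w : Fin n → Carrier) (i : Fin n) → W w ⁅ i ⁆ ≈ w i
  W-⁅⁆ w Fin.zero    = trans (+-congˡ (W-∅ (tail w))) (+-identityʳ _)
  W-⁅⁆ w (Fin.suc i) = W-⁅⁆ (tail w) i

  W-∪ : ∀ {n} (w : Fin n → Carrier) {A B : Subset n} → Disjoint A B → W w (A ∪ B) ≈ W w A + W w B
  W-∪ w {[]}        {[]}        _   = sym (+-identityʳ 0#)
  W-∪ w {true ∷ A}  {true ∷ B}  A#B = ⊥-elim (A#B here here)
  W-∪ w {true ∷ A}  {false ∷ B} A#B =
    trans (+-congˡ (W-∪ (tail w) (λ p q → A#B (there p) (there q)))) (sym (+-assoc _ _ _))
  W-∪ w {false ∷ A} {true ∷ B}  A#B =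
    trans (+-congˡ (W-∪ (tail w) (λ p q → A#B (there p) (there q)))) (x∙yz≈y∙xz _ _ _)
  W-∪ w {false ∷ A} {false ∷ B} A#B = W-∪ (tail w) (λ p q → A#B (there p) (there q))

  W-∪-≤ : ∀ {n} {w : Fin n → Carrier} → NonNegative w → (A B : Subset n) → W w (A ∪ B) ≤ W w A + W w B
  W-∪-≤ w≥0 [] [] = inj₂ (sym (+-identityʳ 0#))
  W-∪-≤ {w = w} w≥0 (true ∷ A) (true ∷ B) = begin
    w₀ + W w′ (A ∪ B)             ≤⟨ +-monoʳ-≤ w₀ (W-∪-≤ (w≥0 ∘ Fin.suc) A B) ⟩
    w₀ + (W w′ A + W w′ B)        ≈⟨ sym (+-assoc _ _ _) ⟩
    (w₀ + W w′ A) + W w′ B        ≤⟨ +-monoʳ-≤ _ (x≤y+x (w≥0 Fin.zero)) ⟩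
    (w₀ + W w′ A) + (w₀ + W w′ B) ∎
    where open ≤-Reasoning; w₀ = w Fin.zero; w′ = tail w
  W-∪-≤ w≥0 (true ∷ A) (false ∷ B) =
    ≤-trans (+-monoʳ-≤ _ (W-∪-≤ (w≥0 ∘ Fin.suc) A B)) (inj₂ (sym (+-assoc _ _ _)))
  W-∪-≤ w≥0 (false ∷ A) (true ∷ B) =
    ≤-trans (+-monoʳ-≤ _ (W-∪-≤ (w≥0 ∘ Fin.suc) A B)) (inj₂ (x∙yz≈y∙xz _ _ _))
  W-∪-≤ w≥0 (false ∷ A) (false ∷ B) = W-∪-≤ (w≥0 ∘ Fin.suc) A B

  W-mono : ∀ {n} {w : Fin n → Carrier} → NonNegative w → {A B : Subset n} → A ⊆ B → W w A ≤ W w B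
  W-mono w≥0 {[]}        {[]}        _   = inj₂ refl
  W-mono w≥0 {true ∷ A}  {true ∷ B}  A⊆B = +-monoʳ-≤ _ (W-mono (w≥0 ∘ Fin.suc) (drop-∷-⊆ A⊆B))
  W-mono w≥0 {true ∷ A}  {false ∷ B} A⊆B with A⊆B here
  ... | ()
  W-mono w≥0 {false ∷ A} {true ∷ B}  A⊆B =
    ≤-trans (W-mono (w≥0 ∘ Fin.suc) (drop-∷-⊆ A⊆B)) (x≤y+x (w≥0 Fin.zero))
  W-mono w≥0 {false ∷ A} {false ∷ B} A⊆B = W-mono (w≥0 ∘ Fin.suc) (drop-∷-⊆ A⊆B)

  ∈-⋃⁺ : ∀ {n} {u : Fin n} {L : List (Subset n)} → u ∈⋃ L → u ∈ ⋃ L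
  ∈-⋃⁺ {L = B ∷ L} (B , here ≡.refl , u∈B) = x∈p∪q⁺ (inj₁ u∈B)
  ∈-⋃⁺ {L = X ∷ L} (B , there B∈L , u∈B)  = x∈p∪q⁺ (inj₂ (∈-⋃⁺ (B , B∈L , u∈B)))

  ∈-⋃⁻ : ∀ {n} {u : Fin n} (L : List (Subset n)) → u ∈ ⋃ L → u ∈⋃ L
  ∈-⋃⁻ []      u∈∅ = ⊥-elim (∉⊥ u∈∅)
  ∈-⋃⁻ (B ∷ L) u∈ with x∈p∪q⁻ B (⋃ L) u∈
  ... | inj₁ u∈B = B , here ≡.refl , u∈B
  ... | inj₂ u∈⋃L with ∈-⋃⁻ L u∈⋃L
  ...   | X , X∈L , u∈X = X , there X∈L , u∈X

  W-⋃-≤ : ∀ {n} {w : Fin n → Carrier} → NonNegative w → (L : List (Subset n)) → W w (⋃ L) ≤ sum (map (W w) L)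
  W-⋃-≤ {w = w} w≥0 []      = inj₂ (W-∅ w)
  W-⋃-≤ {w = w} w≥0 (B ∷ L) = ≤-trans (W-∪-≤ w≥0 B (⋃ L)) (+-monoʳ-≤ (W w B) (W-⋃-≤ w≥0 L))

  W-⋃ : ∀ {n} (w : Fin n → Carrier) {L : List (Subset n)} → AllPairs Disjoint L → W w (⋃ L) ≈ sum (map (W w) L)
  W-⋃ w {[]}    []              = W-∅ w
  W-⋃ w {B ∷ L} (B#L ∷ L-disj) = trans (W-∪ w B#⋃L) (+-congˡ (W-⋃ w L-disj))
    where
    B#⋃L : Disjoint B (⋃ L)
    B#⋃L u∈B u∈⋃L with ∈-⋃⁻ L u∈⋃L
    ... | X , X∈L , u∈X = All.lookup B#L X∈L u∈B u∈X

  length·<W⊤ : ∀ {n} {w : Fin n → Carrier} → NonNegative w → ∀ {x} {L : List (Subset n)} →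
               0 ℕ.< length L → AllPairs Disjoint L → All (λ B → x < W w B) L → (length L · x) < W w ⊤
  length·<W⊤ {w = w} w≥0 {x} {L} 0<|L| L-disj x<W = begin-strict
    length L · x       <⟨ ·-<-sum-map (W w) x 0<|L| x<W ⟩
    sum (map (W w) L)  ≈⟨ sym (W-⋃ w L-disj) ⟩
    W w (⋃ L)          ≤⟨ W-mono w≥0 ⊆⊤ ⟩
    W w ⊤              ∎
    where open ≤-Reasoning

  module _ {n} {w : Fin n → Carrier} {c : ℕ} {P : List (Subset n)} (P-bp : bp w c P) where
    open bp P-bp

    private
      D = deduplicate _≟ₛ_ P

      covers-deduplicate : ∀ u → u ∈⋃ D
      covers-deduplicate u with covers u
      ... | B , B∈P , u∈B = B , ∈-deduplicate⁺ _≟ₛ_ B∈P , u∈B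

    bp⇒0<card : Fin n → 0 ℕ.< card P
    bp⇒0<card u with covers-deduplicate u
    ... | _ , B∈D , _ = ∈⇒0<length B∈D

    bp⇒W⊤≤card· : NonNegative w → W w ⊤ ≤ card P · fromℕ c
    bp⇒W⊤≤card· w≥0 = begin
      W w ⊤               ≤⟨ W-mono w≥0 (λ {u} _ → ∈-⋃⁺ (covers-deduplicate u)) ⟩
      W w (⋃ D)           ≤⟨ W-⋃-≤ w≥0 D ⟩
      sum (map (W w) D)   ≤⟨ sum-map-≤-· (W w) _ (All.tabulate (capacity ∘ ∈-deduplicate⁻ _≟ₛ_ P)) ⟩
      length D · fromℕ c  ∎
      where open ≤-Reasoning

  module Partners {n} {w : Fin n → Carrier} {c : ℕ} {P₁ P₂ : List (Subset n)} {B₁ B₂ V : Subset n}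
    (inv : inv₁ w c P₁ P₂ B₁ B₂ V) (f : Subset n → Fin n)
    (f∈P₂ : ∀ {B} → B ∈ₗ P₁ → f B ∈⋃ (P₂ ++ ⟦ B₂ ⟧))
    (f-injective : ∀ {B B′} → B ∈ₗ P₁ → B′ ∈ₗ P₁ → f B ≡ f B′ → B ≡ B′)
    where
    open inv₁ inv using (isBp; disj)
    open bp isBp using (disjoint)

    private
      P₁⊆packing : ∀ {B} → B ∈ₗ P₁ → B ∈ₗ P₁ ++ ⟦ B₁ ⟧ ++ P₂ ++ ⟦ B₂ ⟧ ++ singletons V
      P₁⊆packing = ∈-++⁺ˡ

      P₂⊆packing : ∀ {B} → B ∈ₗ P₂ ++ ⟦ B₂ ⟧ → B ∈ₗ P₁ ++ ⟦ B₁ ⟧ ++ P₂ ++ ⟦ B₂ ⟧ ++ singletons V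
      P₂⊆packing B∈ =
        ∈-++⁺ʳ P₁ (∈-++⁺ʳ ⟦ B₁ ⟧ (≡.subst (_ ∈ₗ_) (++-assoc P₂ ⟦ B₂ ⟧ _) (∈-++⁺ˡ B∈)))

    partner∉P₁ : ∀ {B B′} → B ∈ₗ P₁ → B′ ∈ₗ P₁ → f B′ ∉ B
    partner∉P₁ {B} B∈P₁ B′∈P₁ fB′∈B with f∈P₂ B′∈P₁
    ... | X , X∈P₂ , fB′∈X with B ≟ₛ X
    ...   | yes ≡.refl = disj (∈-++⁺ˡ B∈P₁) X∈P₂
    ...   | no  B≢X    = disjoint (P₁⊆packing B∈P₁) (P₂⊆packing X∈P₂) B≢X _ fB′∈B fB′∈X

    withPartner : Subset n → Subset n
    withPartner B = B ∪ ⁅ f B ⁆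

    withPartner-disjoint : ∀ {B B′} → B ∈ₗ P₁ → B′ ∈ₗ P₁ → B ≢ B′ →
                           Disjoint (withPartner B) (withPartner B′)
    withPartner-disjoint {B} {B′} B∈ B′∈ B≢B′ u∈ u∈′ with x∈p∪q⁻ B _ u∈ | x∈p∪q⁻ B′ _ u∈′
    ... | inj₁ u∈B   | inj₁ u∈B′  = disjoint (P₁⊆packing B∈) (P₁⊆packing B′∈) B≢B′ _ u∈B u∈B′
    ... | inj₁ u∈B   | inj₂ u∈fB′ = partner∉P₁ B∈ B′∈ (≡.subst (_∈ B) (x∈⁅y⁆⇒x≡y _ u∈fB′) u∈B)
    ... | inj₂ u∈fB  | inj₁ u∈B′  = partner∉P₁ B′∈ B∈ (≡.subst (_∈ B′) (x∈⁅y⁆⇒x≡y _ u∈fB) u∈B′)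
    ... | inj₂ u∈fB  | inj₂ u∈fB′ =
      B≢B′ (f-injective B∈ B′∈ (≡.trans (≡.sym (x∈⁅y⁆⇒x≡y _ u∈fB)) (x∈⁅y⁆⇒x≡y _ u∈fB′)))

    W-withPartner : ∀ {B} → B ∈ₗ P₁ → W w (withPartner B) ≈ W w B + w (f B)
    W-withPartner {B} B∈ = trans (W-∪ w B#fB) (+-congˡ (W-⁅⁆ w (f B)))
      where
      B#fB : Disjoint B ⁅ f B ⁆
      B#fB u∈B u∈fB = partner∉P₁ B∈ B∈ (≡.subst (_∈ B) (x∈⁅y⁆⇒x≡y _ u∈fB) u∈B)

    card·<W⊤ : NonNegative w → (∀ {B} → B ∈ₗ P₁ → fromℕ c < (W w B + w (f B))) →
               0 ℕ.< card P₁ → (card P₁ · fromℕ c) < W w ⊤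
    card·<W⊤ w≥0 overflow 0<card = begin-strict
      length D₁ · fromℕ c          ≡⟨ ≡.cong (_· fromℕ c) (≡.sym (length-map withPartner D₁)) ⟩
      length extended · fromℕ c    <⟨ length·<W⊤ w≥0 0<|extended| extended-disjoint extended-overflow ⟩
      W w ⊤                        ∎
      where
      open ≤-Reasoning
      D₁ = deduplicate _≟ₛ_ P₁
      extended = map withPartner D₁

      0<|extended| : 0 ℕ.< length extended
      0<|extended| = ≡.subst (0 ℕ.<_) (≡.sym (length-map withPartner D₁)) 0<card

      extended-disjoint : AllPairs Disjoint extended
      extended-disjoint = AllPairs.map⁺ (AllPairs-mapWith∈
        (λ B∈ B′∈ → withPartner-disjoint (∈-deduplicate⁻ _≟ₛ_ P₁ B∈) (∈-deduplicate⁻ _≟ₛ_ P₁ B′∈))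
        (Unique.deduplicate-! _≟ₛ_ P₁))

      extended-overflow : All (λ B → fromℕ c < W w B) extended
      extended-overflow = All.map⁺ (All.tabulate (λ B∈ →
        let B∈P₁ = ∈-deduplicate⁻ _≟ₛ_ P₁ B∈ in <-respʳ-≈ (sym (W-withPartner B∈P₁)) (overflow B∈P₁)))

open import Data.Nat using (_≤_; _<_; _+_)
open OrderedCommutativeRing using (Carrier; 0#; fromℕ) renaming (_<_ to _<ᴿ_; _≤_ to _≤ᴿ_)
open BinPacking using (bp; inv₁; bij-exists; _∈⋃_; ⟦_⟧; card)

lemma8p4 : ∀ {a ℓ₁ ℓ₂ : Level} (R : OrderedCommutativeRing a ℓ₁ ℓ₂) →
           ∀ (n : ℕ) → 0 < n →
           ∀ (c : ℕ) (w : Fin n → Carrier R) →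
           (∀ (u : Fin n) → (_<ᴿ_ R (0# R) (w u)) × (_≤ᴿ_ R (w u) (fromℕ R c))) →
           ∀ (P P₁ P₂ : List (Subset n)) (B₁ B₂ V : Subset n) →
           bp R w c P →
           inv₁ R w c P₁ P₂ B₁ B₂ V →
           bij-exists R w c P₁ (λ u → _∈⋃_ R u (P₂ ++ ⟦_⟧ R B₂)) →
           card R P₁ + 1 ≤ card R P
lemma8p4 R (suc n) _ c w w-bounds P P₁ P₂ B₁ B₂ V P-bp inv (f , f∈P₂ , f-injective , _ , overflow) =
  ≡.subst (_≤ card R P) (ℕ.+-comm 1 (card R P₁)) (<-when-positive (bp⇒0<card P-bp Fin.zero) fewer)
  where
  open OrderedCommutativeRingProperties R using (≤-trans; _·_; ·-cancelʳ-<; module ≤-Reasoning)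
  open BinPackingProperties R using (NonNegative; bp⇒0<card; bp⇒W⊤≤card·; module Partners)
  open Partners inv f f∈P₂ f-injective using (card·<W⊤)

  w≥0 : NonNegative w
  w≥0 u = inj₁ (proj₁ (w-bounds u))

  fewer : 0 < card R P₁ → card R P₁ < card R P
  fewer 0<card = ·-cancelʳ-< (≤-trans (w≥0 Fin.zero) (proj₂ (w-bounds Fin.zero))) (begin-strict
    card R P₁ · fromℕ R c  <⟨ card·<W⊤ w≥0 overflow 0<card ⟩
    BinPacking.W R w ⊤     ≤⟨ bp⇒W⊤≤card· P-bp w≥0 ⟩
    card R P · fromℕ R c   ∎)
    where open ≤-Reasoning
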